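{- Let $\mathcal I$ be a canonical instance that admits an assignment of items which $1$-satisfies all agents, and let $P$ be a good assignment of private items. Then there is a feasible (integral) flow in the network $N(\mathcal{I},P)$.
   Context: Canonical instance: value $M$; agents partitioned into light agents $L$ and heavy agents $H$; each heavy agent $A$ has a set $\Gamma(A)$ of items of utility $M$; each light agent $A$ has a distinct heavy item $h(A)$ of utility $M$, an integer $N_A$, and a set $S(A)$ of items of utility $M/N_A$. An assignment $1$-satisfies all agents if every heavy agent gets an item of $\Gamma(A)$ and every light agent $A$ gets $h(A)$ or at least $N_A$ items of $S(A)$. A good assignment of private items $P$: each light agent $A$ gets $P(A)=h(A)$; each item is private for at most one agent; some heavy agents $A$ get a private item $P(A)\in\Gamma(A)$, forming $H'$; the remaining heavy agents are terminals, $T$; $S$ is the set of items that are not private items of anyone. The directed network $N(\mathcal I,P)$ has vertex set $\mathcal A\cup I\cup\{s\}$ and edges $s\to i$ for $i\in S$; $A\to P(A)$ for each agent having a private item; $i\to A$ for heavy $A$ and $i\in\Gamma(A)\setminus\{P(A)\}$; $i\to A$ for light $A$ and $i\in S(A)$. A feasible flow is an integral flow such that: all flow originates at $s$; each terminal receives exactly one unit; for each non-terminal heavy agent, each item, the incoming flow is $1$ and outgoing is $1$, or both are $0$; for each light agent $A$, either the incoming flow is $N_A$ and the outgoing flow is $1$, or both are $0$. -}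

module Defs where

open import Data.Nat using (ℕ; zero; suc; _+_; _≤_; _<_)
open import Data.Fin using (Fin)
open import Data.Fin.Subset using (Subset; _∈_)
open import Data.Sum using (_⊎_; inj₁; inj₂)
open import Data.Product using (Σ; _×_; ∃; _,_)
open import Data.Maybe using (Maybe; just; nothing)
open import Data.List using (List; []; _∷_; _++_; map; allFin)
open import Data.Nat.ListAction using (sum)
open import Data.Empty using (⊥)
open import Relation.Binary.PropositionalEquality using (_≡_; _≢_)
open import Relation.Nullary using (¬_)
open import Function.Definitions using (Injective)

-- Only the data relevant to 1-satisfaction and to the network is kept:
-- the value M (and utilities M, M/N_A) do not enter these notions.

record Instance : Set where
  field
    nL nH m : ℕ
    Γ       : Fin nH → Subset m          -- heavy agent A: items of utility M
    h       : Fin nL → Fin m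
    h-inj   : Injective _≡_ _≡_ h
    N       : Fin nL → ℕ
    N-pos   : ∀ A → 1 ≤ N A
    S       : Fin nL → Subset m          -- light agent A: items of utility M/N_A

module _ (I : Instance) where
  open Instance I

  Agent : Set
  Agent = Fin nL ⊎ Fin nH

  Item : Set
  Item = Fin m

  Assignment : Set
  Assignment = Item → Maybe Agent

  OneSatisfiesAll : Assignment → Set
  OneSatisfiesAll σ =
    (∀ (A : Fin nH) → ∃ λ (i : Item) → i ∈ Γ A × σ i ≡ just (inj₂ A))
    × (∀ (A : Fin nL) →
         σ (h A) ≡ just (inj₁ A)
         ⊎ Σ (Fin (N A) → Item) λ f →
             Injective _≡_ _≡_ f × (∀ k → f k ∈ S A × σ (f k) ≡ just (inj₁ A)))

  -- Light agents A always have
  -- P(A) = h(A); a heavy agent A has P(A) = just i (A ∈ H') with i ∈ Γ(A),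
  -- or P(A) = nothing (A is a terminal).
  -- the private item of each agent, given the heavy agents' part Pₕ
  privOf : (Fin nH → Maybe Item) → Agent → Maybe Item
  privOf Pₕ (inj₁ A) = just (h A)
  privOf Pₕ (inj₂ A) = Pₕ A

  record GoodPrivate : Set where
    field
      Pₕ       : Fin nH → Maybe Item
      Pₕ-Γ     : ∀ A i → Pₕ A ≡ just i → i ∈ Γ A
      P-unique : ∀ a b i → privOf Pₕ a ≡ just i → privOf Pₕ b ≡ just i → a ≡ b

    P : Agent → Maybe Item
    P = privOf Pₕ

  module Network (Pr : GoodPrivate) where
    open GoodPrivate Pr

    IsTerminal : Fin nH → Set
    IsTerminal A = Pₕ A ≡ nothing

    NonPrivate : Item → Set
    NonPrivate i = ∀ a → P a ≢ just i

    data Vertex : Set where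
      src   : Vertex
      agent : Agent → Vertex
      item  : Item → Vertex

    vertices : List Vertex
    vertices = src ∷ (map (λ A → agent (inj₁ A)) (allFin nL)
                   ++ map (λ A → agent (inj₂ A)) (allFin nH)
                   ++ map item (allFin m))

    IsEdge : Vertex → Vertex → Set
    IsEdge src        (item i)           = NonPrivate i
    IsEdge (agent a)  (item i)           = P a ≡ just i
    IsEdge (item i)   (agent (inj₂ A))   = i ∈ Γ A × Pₕ A ≢ just i
    IsEdge (item i)   (agent (inj₁ A))   = i ∈ S A
    IsEdge _          _                  = ⊥

    record Flow : Set where
      field
        f       : Vertex → Vertex → ℕ
        support : ∀ u v → 0 < f u v → IsEdge u v

      inflow : Vertex → ℕ
      inflow v = sum (map (λ u → f u v) vertices)

      outflow : Vertex → ℕ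
      outflow u = sum (map (λ v → f u v) vertices)

    -- Feasibility.  "All flow originates at s": s has no incoming edges,
    -- and every other vertex receives at least as much as it sends out,
    -- by the constraints below.
    Feasible : Flow → Set
    Feasible F =
      (∀ (A : Fin nH) → IsTerminal A → inflow (agent (inj₂ A)) ≡ 1)
      × (∀ (A : Fin nH) → ¬ IsTerminal A →
           (inflow (agent (inj₂ A)) ≡ 1 × outflow (agent (inj₂ A)) ≡ 1)
           ⊎ (inflow (agent (inj₂ A)) ≡ 0 × outflow (agent (inj₂ A)) ≡ 0))
      × (∀ (i : Item) →
           (inflow (item i) ≡ 1 × outflow (item i) ≡ 1)
           ⊎ (inflow (item i) ≡ 0 × outflow (item i) ≡ 0))
      × (∀ (A : Fin nL) →
           (inflow (agent (inj₁ A)) ≡ N A × outflow (agent (inj₁ A)) ≡ 1)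
           ⊎ (inflow (agent (inj₁ A)) ≡ 0 × outflow (agent (inj₁ A)) ≡ 0))
      where open Flow F

-- An item i is a witness of agent a if σ 1-satisfies a through i; each item witnesses at
-- most one agent. Send the witness i of a on to a's private item P(a), or halt if a is a terminal.
-- Route one unit of flow along every such walk that halts: into i (from s, or from the agent owning i
-- privately), then on to the agent it witnesses. A heavy agent has exactly one witness, and the N_A
-- witnesses of a light agent A are all sent to h(A), so they carry flow exactly when h(A) does; this
-- yields the conservation constraints. A walk that halts does so within as many steps as there are
-- items (pigeonhole), which makes halting decidable.
module Submission where

open import Defs
open import Data.Bool using (Bool; true; false)
open import Data.Empty using (⊥; ⊥-elim)
open import Data.Fin using (Fin; zero; suc) renaming (_≟_ to _≟ᶠ_)
open import Data.Fin.Properties using (any?; injective⇒≤)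
open import Data.Fin.Subset using (_∈_)
open import Data.List using (map; allFin; tabulate; _++_)
open import Data.List.Properties using (map-∘; map-tabulate; map-++)
open import Data.Maybe using (Maybe; just; nothing)
open import Data.Maybe.Properties using (just-injective) renaming (≡-dec to ≡-decᵐ)
open import Data.Nat using (ℕ; zero; suc; _+_; _*_; _≤_; _<_; z≤n; s≤s)
open import Data.Nat.ListAction using (sum)
open import Data.Nat.ListAction.Properties using (sum-++)
open import Data.Nat.Properties
  using (≤-refl; m≤n⇒m≤1+n; <-cmp; <⇒≢; <-irrefl; +-identityʳ; +-assoc; *-identityʳ; *-zeroʳ; *-distribˡ-+;
         +-*-semiring)
open import Algebra.Properties.Semiring.Sum +-*-semiring
  using (sum-syntax; sum-cong-≗; sum-replicate-zero; ∑-comm; *-distribˡ-sum)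
open import Data.Product using (Σ; ∃; _×_; _,_; proj₁; proj₂)
open import Data.Sum using (_⊎_; inj₁; inj₂)
open import Data.Sum.Properties using (inj₁-injective; inj₂-injective)
open import Function using (_∘_; id)
open import Function.Definitions using (Injective)
open import Relation.Binary using (tri<; tri≈; tri>)
open import Relation.Binary.PropositionalEquality
  using (_≡_; _≢_; refl; sym; trans; cong; cong₂; subst; module ≡-Reasoning)
open import Relation.Nullary using (¬_; Dec; yes; no)
open import Relation.Nullary.Decidable using (map′; _⊎-dec_; ¬?)

data Step (n : ℕ) : Set where
  halt fail : Step n
  next      : Fin n → Step n

module Walk {n : ℕ} (step : Fin n → Step n) where

  haltsWithin : ℕ → Fin n → Bool
  outcomeWithin : ℕ → Step n → Bool
  haltsWithin zero    x = false
  haltsWithin (suc k) x = outcomeWithin k (step x)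
  outcomeWithin k halt     = true
  outcomeWithin k fail     = false
  outcomeWithin k (next y) = haltsWithin k y

  haltsWithin-mono : ∀ {k l} x → k ≤ l → haltsWithin k x ≡ true → haltsWithin l x ≡ true
  haltsWithin-mono {suc k} {suc l} x (s≤s k≤l) halts with step x
  ... | halt   = refl
  ... | next y = haltsWithin-mono y k≤l halts

  FirstHalt : ℕ → Fin n → Set
  FirstHalt k x = haltsWithin (suc k) x ≡ true × haltsWithin k x ≡ false

  firstHalt-next : ∀ k x → FirstHalt (suc k) x → ∃ λ y → step x ≡ next y × FirstHalt k y
  firstHalt-next k x first with step x
  firstHalt-next k x (() , _) | fail
  firstHalt-next k x (_ , ()) | halt
  ... | next y = y , refl , first

  firstHalt-unique : ∀ {k l} x → FirstHalt k x → FirstHalt l x → k ≡ l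
  firstHalt-unique {k} {l} x (haltsₖ , notₖ) (haltsₗ , notₗ) with <-cmp k l
  ... | tri≈ _ k≡l _ = k≡l
  ... | tri< k<l _ _ with () ← trans (sym (haltsWithin-mono x k<l haltsₖ)) notₗ
  ... | tri> _ _ l<k with () ← trans (sym (haltsWithin-mono x l<k haltsₗ)) notₖ

  -- The first k + 1 points of a walk that first halts after k + 1 steps are distinct,
  -- because they first halt after different numbers of steps.
  firstHalt-walk : ∀ k x → FirstHalt k x →
    Σ (Fin (suc k) → Fin n) λ walk →
      Injective _≡_ _≡_ walk × (∀ t → ∃ λ j → j ≤ k × FirstHalt j (walk t))
  firstHalt-walk zero x first = (λ _ → x) , (λ { {zero} {zero} _ → refl }) , λ _ → zero , z≤n , first
  firstHalt-walk (suc k) x first with firstHalt-next k x first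
  ... | y , _ , firstʸ with firstHalt-walk k y firstʸ
  ... | walk , walk-inj , times = walk′ , walk′-inj , times′
    where
      walk′ : Fin (suc (suc k)) → Fin n
      walk′ zero    = x
      walk′ (suc t) = walk t

      x∉walk : ∀ t → x ≢ walk t
      x∉walk t x≡ with times t
      ... | j , j≤k , firstʲ =
        <⇒≢ (s≤s j≤k) (firstHalt-unique x (subst (FirstHalt j) (sym x≡) firstʲ) first)

      walk′-inj : Injective _≡_ _≡_ walk′
      walk′-inj {zero}  {zero}  _ = refl
      walk′-inj {zero}  {suc u} e = ⊥-elim (x∉walk u e)
      walk′-inj {suc t} {zero}  e = ⊥-elim (x∉walk t (sym e))
      walk′-inj {suc t} {suc u} e = cong suc (walk-inj e)

      times′ : ∀ t → ∃ λ j → j ≤ suc k × FirstHalt j (walk′ t)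
      times′ zero    = suc k , ≤-refl , first
      times′ (suc t) with times t
      ... | j , j≤k , firstʲ = j , m≤n⇒m≤1+n j≤k , firstʲ

  firstHalt-< : ∀ k x → FirstHalt k x → k < n
  firstHalt-< k x first with firstHalt-walk k x first
  ... | _ , walk-inj , _ = injective⇒≤ walk-inj

  haltsWithin-saturates : ∀ x → haltsWithin (suc n) x ≡ haltsWithin n x
  haltsWithin-saturates x with haltsWithin n x in haltsₙ | haltsWithin (suc n) x in haltsₙ₊₁
  ... | true  | _     = trans (sym haltsₙ₊₁) (haltsWithin-mono x (m≤n⇒m≤1+n ≤-refl) haltsₙ)
  ... | false | false = refl
  ... | false | true  = ⊥-elim (<-irrefl refl (firstHalt-< n x (haltsₙ₊₁ , haltsₙ)))

  Halts : Fin n → Bool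
  Halts = haltsWithin n

  outcome : Step n → Bool
  outcome = outcomeWithin n

  Halts-unfold : ∀ x → Halts x ≡ outcome (step x)
  Halts-unfold x = sym (haltsWithin-saturates x)

  Halts-selfLoop : ∀ x → step x ≡ next x → Halts x ≡ false
  Halts-selfLoop x loop = never n
    where
      never : ∀ k → haltsWithin k x ≡ false
      never zero    = refl
      never (suc k) rewrite loop = never k

bit : Bool → ℕ
bit true  = 1
bit false = 0

𝟙 : ∀ {ℓ} {P : Set ℓ} → Dec P → ℕ
𝟙 (yes _) = 1
𝟙 (no _)  = 0

𝟙-yes : ∀ {ℓ} {P : Set ℓ} → P → (d : Dec P) → 𝟙 d ≡ 1
𝟙-yes p (yes _) = refl
𝟙-yes p (no ¬p) = ⊥-elim (¬p p)

𝟙-no : ∀ {ℓ} {P : Set ℓ} → ¬ P → (d : Dec P) → 𝟙 d ≡ 0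
𝟙-no ¬p (yes p) = ⊥-elim (¬p p)
𝟙-no ¬p (no _)  = refl

bit*𝟙-positive : ∀ {ℓ} {P : Set ℓ} b (d : Dec P) → 0 < bit b * 𝟙 d → b ≡ true × P
bit*𝟙-positive true (yes p) _ = refl , p

bit-cases : ∀ b c {x y} → x ≡ bit b * c → y ≡ bit b → (x ≡ c × y ≡ 1) ⊎ (x ≡ 0 × y ≡ 0)
bit-cases true  c x≡ y≡ = inj₁ (trans x≡ (+-identityʳ c) , y≡)
bit-cases false c x≡ y≡ = inj₂ (x≡ , y≡)

bit-cases₁ : ∀ b {x y} → x ≡ bit b → y ≡ bit b → (x ≡ 1 × y ≡ 1) ⊎ (x ≡ 0 × y ≡ 0)
bit-cases₁ true  x≡ y≡ = inj₁ (x≡ , y≡)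
bit-cases₁ false x≡ y≡ = inj₂ (x≡ , y≡)

sum-tabulate : ∀ {n} (g : Fin n → ℕ) → sum (tabulate g) ≡ ∑[ i < n ] g i
sum-tabulate {zero}  g = refl
sum-tabulate {suc n} g = cong (g zero +_) (sum-tabulate (g ∘ suc))

sum-map-allFin : ∀ {n} {A : Set} (g : A → ℕ) (k : Fin n → A) → sum (map g (map k (allFin n))) ≡ ∑[ i < n ] g (k i)
sum-map-allFin {n} g k = begin
  sum (map g (map k (allFin n)))  ≡⟨ cong sum (map-∘ (allFin n)) ⟨
  sum (map (g ∘ k) (allFin n))    ≡⟨ cong sum (map-tabulate id (g ∘ k)) ⟩
  sum (tabulate (g ∘ k))          ≡⟨ sum-tabulate (g ∘ k) ⟩
  ∑[ i < n ] g (k i)              ∎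
  where open ≡-Reasoning

∑-zero : ∀ {n} (g : Fin n → ℕ) → (∀ i → g i ≡ 0) → ∑[ i < n ] g i ≡ 0
∑-zero {n} g g≡0 = trans (sum-cong-≗ g≡0) (sum-replicate-zero n)

∑-single : ∀ {n} (g : Fin n → ℕ) k → (∀ i → i ≢ k → g i ≡ 0) → ∑[ i < n ] g i ≡ g k
∑-single {suc n} g zero    g≡0 =
  trans (cong (g zero +_) (∑-zero (g ∘ suc) (λ i → g≡0 (suc i) λ ()))) (+-identityʳ _)
∑-single {suc n} g (suc k) g≡0 =
  cong₂ _+_ (g≡0 zero λ ()) (∑-single (g ∘ suc) k (λ i i≢k → g≡0 (suc i) (λ { refl → i≢k refl })))

∑-𝟙-unique : ∀ {ℓ n} {Q : Fin n → Set ℓ} (Q? : ∀ i → Dec (Q i)) k →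
             Q k → (∀ i → Q i → i ≡ k) → ∑[ i < n ] 𝟙 (Q? i) ≡ 1
∑-𝟙-unique Q? k Qk unique =
  trans (∑-single _ k (λ i i≢k → 𝟙-no (λ Qi → i≢k (unique i Qi)) (Q? i))) (𝟙-yes Qk (Q? k))

∑-*𝟙-unique : ∀ {ℓ n} {Q : Fin n → Set ℓ} (g : Fin n → ℕ) (Q? : ∀ i → Dec (Q i)) k →
              Q k → (∀ i → Q i → i ≡ k) → ∑[ i < n ] (g i * 𝟙 (Q? i)) ≡ g k
∑-*𝟙-unique {n = n} g Q? k Qk unique = begin
  ∑[ i < n ] (g i * 𝟙 (Q? i))  ≡⟨ ∑-single _ k off-k ⟩
  g k * 𝟙 (Q? k)               ≡⟨ cong (g k *_) (𝟙-yes Qk (Q? k)) ⟩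
  g k * 1                      ≡⟨ *-identityʳ (g k) ⟩
  g k                          ∎
  where
    open ≡-Reasoning
    off-k : ∀ i → i ≢ k → g i * 𝟙 (Q? i) ≡ 0
    off-k i i≢k = trans (cong (g i *_) (𝟙-no (λ Qi → i≢k (unique i Qi)) (Q? i))) (*-zeroʳ (g i))

∑-*𝟙-constant : ∀ {ℓ n} {Q : Fin n → Set ℓ} (g : Fin n → ℕ) (Q? : ∀ i → Dec (Q i)) c →
                (∀ i → Q i → g i ≡ c) → ∑[ i < n ] (g i * 𝟙 (Q? i)) ≡ c * ∑[ i < n ] 𝟙 (Q? i)
∑-*𝟙-constant g Q? c g≡c = trans (sum-cong-≗ termwise) (sym (*-distribˡ-sum c (𝟙 ∘ Q?)))
  where
    termwise : ∀ i → g i * 𝟙 (Q? i) ≡ c * 𝟙 (Q? i)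
    termwise i with Q? i
    ... | yes Qi = cong (_* 1) (g≡c i Qi)
    ... | no _   = trans (*-zeroʳ (g i)) (sym (*-zeroʳ c))

∑-𝟙-image : ∀ {k n} (f : Fin k → Fin n) → Injective _≡_ _≡_ f →
            ∑[ j < n ] 𝟙 (any? λ t → f t ≟ᶠ j) ≡ k
∑-𝟙-image {k} {n} f f-inj = begin
  ∑[ j < n ] 𝟙 (any? λ t → f t ≟ᶠ j)  ≡⟨ sum-cong-≗ (λ j → preimage-size j (any? λ t → f t ≟ᶠ j)) ⟩
  ∑[ j < n ] ∑[ t < k ] 𝟙 (f t ≟ᶠ j)   ≡⟨ ∑-comm (λ j t → 𝟙 (f t ≟ᶠ j)) ⟩
  ∑[ t < k ] ∑[ j < n ] 𝟙 (f t ≟ᶠ j)   ≡⟨ sum-cong-≗ (λ t → ∑-𝟙-unique (f t ≟ᶠ_) (f t) refl (λ _ → sym)) ⟩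
  ∑[ t < k ] 1                          ≡⟨ ∑-one k ⟩
  k                                     ∎
  where
    open ≡-Reasoning
    preimage-size : ∀ j (d : Dec (∃ λ t → f t ≡ j)) → 𝟙 d ≡ ∑[ t < k ] 𝟙 (f t ≟ᶠ j)
    preimage-size j (yes (t₀ , ft₀≡j)) =
      sym (∑-𝟙-unique (λ t → f t ≟ᶠ j) t₀ ft₀≡j (λ t ft≡j → f-inj (trans ft≡j (sym ft₀≡j))))
    preimage-size j (no ∄t) = sym (∑-zero _ (λ t → 𝟙-no (λ ft≡j → ∄t (t , ft≡j)) (f t ≟ᶠ j)))
    ∑-one : ∀ m → ∑[ t < m ] 1 ≡ m
    ∑-one zero    = refl
    ∑-one (suc m) = cong suc (∑-one m)

∑⊎ : ∀ {p q} → (Fin p ⊎ Fin q → ℕ) → ℕ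
∑⊎ {p} {q} g = ∑[ i < p ] g (inj₁ i) + ∑[ j < q ] g (inj₂ j)

∑⊎-zero : ∀ {p q} (g : Fin p ⊎ Fin q → ℕ) → (∀ a → g a ≡ 0) → ∑⊎ g ≡ 0
∑⊎-zero g g≡0 = cong₂ _+_ (∑-zero _ (g≡0 ∘ inj₁)) (∑-zero _ (g≡0 ∘ inj₂))

∑⊎-𝟙-unique : ∀ {ℓ p q} {Q : Fin p ⊎ Fin q → Set ℓ} (Q? : ∀ a → Dec (Q a)) k →
              Q k → (∀ a → Q a → a ≡ k) → ∑⊎ (𝟙 ∘ Q?) ≡ 1
∑⊎-𝟙-unique Q? (inj₁ k) Qk unique = cong₂ _+_
  (∑-𝟙-unique (Q? ∘ inj₁) k Qk (λ i Qi → inj₁-injective (unique (inj₁ i) Qi)))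
  (∑-zero _ (λ j → 𝟙-no (λ Qj → inj₂≢inj₁ (unique (inj₂ j) Qj)) (Q? (inj₂ j))))
  where inj₂≢inj₁ : ∀ {j} → inj₂ j ≢ inj₁ k
        inj₂≢inj₁ ()
∑⊎-𝟙-unique Q? (inj₂ k) Qk unique = cong₂ _+_
  (∑-zero _ (λ i → 𝟙-no (λ Qi → inj₁≢inj₂ (unique (inj₁ i) Qi)) (Q? (inj₁ i))))
  (∑-𝟙-unique (Q? ∘ inj₂) k Qk (λ j Qj → inj₂-injective (unique (inj₂ j) Qj)))
  where inj₁≢inj₂ : ∀ {i} → inj₁ i ≢ inj₂ k
        inj₁≢inj₂ ()

*-distribˡ-∑⊎ : ∀ {p q} c (g : Fin p ⊎ Fin q → ℕ) → c * ∑⊎ g ≡ ∑⊎ (λ a → c * g a)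
*-distribˡ-∑⊎ c g =
  trans (*-distribˡ-+ c _ _) (cong₂ _+_ (*-distribˡ-sum c (g ∘ inj₁)) (*-distribˡ-sum c (g ∘ inj₂)))

any⊎? : ∀ {ℓ p q} {Q : Fin p ⊎ Fin q → Set ℓ} → (∀ a → Dec (Q a)) → Dec (∃ Q)
any⊎? {Q = Q} Q? = map′ from to (any? (Q? ∘ inj₁) ⊎-dec any? (Q? ∘ inj₂))
  where
    from : (∃ (Q ∘ inj₁)) ⊎ (∃ (Q ∘ inj₂)) → ∃ Q
    from (inj₁ (i , Qi)) = inj₁ i , Qi
    from (inj₂ (j , Qj)) = inj₂ j , Qj
    to : ∃ Q → (∃ (Q ∘ inj₁)) ⊎ (∃ (Q ∘ inj₂))
    to (inj₁ i , Qi) = inj₁ (i , Qi)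
    to (inj₂ j , Qj) = inj₂ (j , Qj)

module FeasibleFlow (I : Instance) (σ : Assignment I) (sat : OneSatisfiesAll I σ) (Pr : GoodPrivate I) where
  open Instance I
  open GoodPrivate Pr
  open Network I Pr

  LightSatisfied : Fin nL → Set
  LightSatisfied A = σ (h A) ≡ just (inj₁ A)
    ⊎ Σ (Fin (N A) → Item I) λ f → Injective _≡_ _≡_ f × (∀ k → f k ∈ S A × σ (f k) ≡ just (inj₁ A))

  heavyItem : Fin nH → Item I
  heavyItem A = proj₁ (proj₁ sat A)

  LightWitness : ∀ {A} → LightSatisfied A → Item I → Set
  LightWitness (inj₁ _)       i = ⊥
  LightWitness (inj₂ (f , _)) i = ∃ λ k → f k ≡ i

  Witness : Item I → Agent I → Set
  Witness i (inj₁ A) = LightWitness (proj₂ sat A) i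
  Witness i (inj₂ A) = i ≡ heavyItem A

  lightWitness? : ∀ {A} (s : LightSatisfied A) i → Dec (LightWitness s i)
  lightWitness? (inj₁ _)       i = no λ ()
  lightWitness? (inj₂ (f , _)) i = any? λ k → f k ≟ᶠ i

  witness? : ∀ i a → Dec (Witness i a)
  witness? i (inj₁ A) = lightWitness? (proj₂ sat A) i
  witness? i (inj₂ A) = i ≟ᶠ heavyItem A

  lightWitness-assigned : ∀ {A} (s : LightSatisfied A) i → LightWitness s i → σ i ≡ just (inj₁ A)
  lightWitness-assigned (inj₂ (f , _ , f-ok)) i (k , refl) = proj₂ (f-ok k)

  lightWitness-∈S : ∀ {A} (s : LightSatisfied A) i → LightWitness s i → i ∈ S A
  lightWitness-∈S (inj₂ (f , _ , f-ok)) i (k , refl) = proj₁ (f-ok k)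

  witness-assigned : ∀ i a → Witness i a → σ i ≡ just a
  witness-assigned i (inj₁ A) w    = lightWitness-assigned (proj₂ sat A) i w
  witness-assigned i (inj₂ A) refl = proj₂ (proj₂ (proj₁ sat A))

  witness-unique : ∀ i a b → Witness i a → Witness i b → a ≡ b
  witness-unique i a b wa wb = just-injective (trans (sym (witness-assigned i a wa)) (witness-assigned i b wb))

  afterAgent : Maybe (Item I) → Step m
  afterAgent nothing  = halt
  afterAgent (just i) = next i

  successor : Item I → Step m
  successor i with any⊎? (witness? i)
  ... | yes (a , _) = afterAgent (P a)
  ... | no _        = fail

  open Walk successor

  successor-witness : ∀ i a → Witness i a → successor i ≡ afterAgent (P a)
  successor-witness i a w with any⊎? (witness? i)
  ... | yes (b , w′) = cong (afterAgent ∘ P) (witness-unique i b a w′ w)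
  ... | no ∄w        = ⊥-elim (∄w (a , w))

  successor-unwitnessed : ∀ i → ¬ ∃ (Witness i) → successor i ≡ fail
  successor-unwitnessed i ∄w with any⊎? (witness? i)
  ... | yes w = ⊥-elim (∄w w)
  ... | no _  = refl

  Halts-witness : ∀ i a → Witness i a → Halts i ≡ outcome (afterAgent (P a))
  Halts-witness i a w = trans (Halts-unfold i) (cong outcome (successor-witness i a w))

  Halts-unwitnessed : ∀ i → ¬ ∃ (Witness i) → Halts i ≡ false
  Halts-unwitnessed i ∄w = trans (Halts-unfold i) (cong outcome (successor-unwitnessed i ∄w))

  privateOf? : ∀ a i → Dec (P a ≡ just i)
  privateOf? a i = ≡-decᵐ _≟ᶠ_ (P a) (just i)

  private? : ∀ i → Dec (∃ λ a → P a ≡ just i)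
  private? i = any⊎? (λ a → privateOf? a i)

  used : Item I → ℕ
  used i = bit (Halts i)

  flow : Vertex → Vertex → ℕ
  flow src       (item i)  = used i * 𝟙 (¬? (private? i))
  flow (agent a) (item i)  = used i * 𝟙 (privateOf? a i)
  flow (item i)  (agent a) = used i * 𝟙 (witness? i a)
  flow _         _         = 0

  flow-support : ∀ u v → 0 < flow u v → IsEdge u v
  flow-support src (item i) pos with bit*𝟙-positive (Halts i) (¬? (private? i)) pos
  ... | _ , ∄a = λ a Pa≡i → ∄a (a , Pa≡i)
  flow-support (agent a) (item i) pos = proj₂ (bit*𝟙-positive (Halts i) (privateOf? a i) pos)
  flow-support (item i) (agent (inj₁ A)) pos =
    lightWitness-∈S (proj₂ sat A) i (proj₂ (bit*𝟙-positive (Halts i) (witness? i (inj₁ A)) pos))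
  flow-support (item i) (agent (inj₂ A)) pos with bit*𝟙-positive (Halts i) (witness? i (inj₂ A)) pos
  ... | halts , refl = proj₁ (proj₂ (proj₁ sat A)) , noSelfLoop
    where
      noSelfLoop : Pₕ A ≢ just i
      noSelfLoop selfLoop
        with () ← trans (sym halts) (Halts-selfLoop i (trans (successor-witness i (inj₂ A) refl) (cong afterAgent selfLoop)))
  flow-support src       src       ()
  flow-support src       (agent _) ()
  flow-support (agent _) src       ()
  flow-support (agent _) (agent _) ()
  flow-support (item _)  src       ()
  flow-support (item _)  (item _)  ()

  F : Flow
  F = record { f = flow ; support = flow-support }

  open Flow F

  sum-vertices : ∀ (g : Vertex → ℕ) →
    sum (map g vertices) ≡ g src + (∑⊎ (g ∘ agent) + ∑[ i < m ] g (item i))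
  sum-vertices g = cong (g src +_) (begin
    sum (map g (Ls ++ Hs ++ Is))                       ≡⟨ cong sum (map-++ g Ls (Hs ++ Is)) ⟩
    sum (map g Ls ++ map g (Hs ++ Is))                 ≡⟨ sum-++ (map g Ls) _ ⟩
    sum (map g Ls) + sum (map g (Hs ++ Is))            ≡⟨ cong (sum (map g Ls) +_) (cong sum (map-++ g Hs Is)) ⟩
    sum (map g Ls) + sum (map g Hs ++ map g Is)        ≡⟨ cong (sum (map g Ls) +_) (sum-++ (map g Hs) _) ⟩
    sum (map g Ls) + (sum (map g Hs) + sum (map g Is)) ≡⟨ +-assoc (sum (map g Ls)) _ _ ⟨
    sum (map g Ls) + sum (map g Hs) + sum (map g Is)   ≡⟨ cong₂ _+_ (cong₂ _+_ (sum-map-allFin g (agent ∘ inj₁)) (sum-map-allFin g (agent ∘ inj₂)))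
                                                                  (sum-map-allFin g item) ⟩
    ∑⊎ (g ∘ agent) + ∑[ i < m ] g (item i)             ∎)
    where
      open ≡-Reasoning
      Ls = map (λ A → agent (inj₁ A)) (allFin nL)
      Hs = map (λ A → agent (inj₂ A)) (allFin nH)
      Is = map item (allFin m)

  inflow-agent : ∀ a → inflow (agent a) ≡ ∑[ j < m ] flow (item j) (agent a)
  inflow-agent a =
    trans (sum-vertices (λ u → flow u (agent a))) (cong (_+ ∑[ j < m ] flow (item j) (agent a)) (∑⊎-zero (λ b → flow (agent b) (agent a)) (λ _ → refl)))

  outflow-agent : ∀ a → outflow (agent a) ≡ ∑[ i < m ] flow (agent a) (item i)
  outflow-agent a =
    trans (sum-vertices (flow (agent a))) (cong (_+ ∑[ i < m ] flow (agent a) (item i)) (∑⊎-zero (λ b → flow (agent a) (agent b)) (λ _ → refl)))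

  inflow-item : ∀ i → inflow (item i) ≡ flow src (item i) + ∑⊎ (λ a → flow (agent a) (item i))
  inflow-item i = trans (sum-vertices (λ u → flow u (item i)))
    (cong (flow src (item i) +_) (trans (cong (into +_) (∑-zero {m} _ (λ _ → refl))) (+-identityʳ into)))
    where into = ∑⊎ (λ a → flow (agent a) (item i))

  outflow-item : ∀ i → outflow (item i) ≡ ∑⊎ (λ a → flow (item i) (agent a))
  outflow-item i = trans (sum-vertices (flow (item i)))
    (trans (cong (out +_) (∑-zero {m} _ (λ _ → refl))) (+-identityʳ out))
    where out = ∑⊎ (λ a → flow (item i) (agent a))

  private-count : ∀ i → 𝟙 (¬? (private? i)) + ∑⊎ (λ a → 𝟙 (privateOf? a i)) ≡ 1
  private-count i with private? i
  ... | yes (a , Pa≡i) = ∑⊎-𝟙-unique (λ b → privateOf? b i) a Pa≡i (λ b Pb≡i → P-unique b a i Pb≡i Pa≡i)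
  ... | no ∄a          = cong suc (∑⊎-zero _ (λ a → 𝟙-no (λ Pa≡i → ∄a (a , Pa≡i)) (privateOf? a i)))

  inflow-item≡used : ∀ i → inflow (item i) ≡ used i
  inflow-item≡used i = begin
    inflow (item i)                                                    ≡⟨ inflow-item i ⟩
    used i * 𝟙 (¬? (private? i)) + ∑⊎ (λ a → used i * 𝟙 (privateOf? a i))
      ≡⟨ cong (used i * 𝟙 (¬? (private? i)) +_) (*-distribˡ-∑⊎ (used i) (λ a → 𝟙 (privateOf? a i))) ⟨
    used i * 𝟙 (¬? (private? i)) + used i * ∑⊎ (λ a → 𝟙 (privateOf? a i))
      ≡⟨ *-distribˡ-+ (used i) _ _ ⟨
    used i * (𝟙 (¬? (private? i)) + ∑⊎ (λ a → 𝟙 (privateOf? a i))) ≡⟨ cong (used i *_) (private-count i) ⟩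
    used i * 1                                                         ≡⟨ *-identityʳ (used i) ⟩
    used i                                                             ∎
    where open ≡-Reasoning

  outflow-item≡used : ∀ i → outflow (item i) ≡ used i
  outflow-item≡used i with any⊎? (witness? i)
  ... | yes (a , w) = begin
    outflow (item i)                             ≡⟨ outflow-item i ⟩
    ∑⊎ (λ b → used i * 𝟙 (witness? i b))         ≡⟨ *-distribˡ-∑⊎ (used i) (𝟙 ∘ witness? i) ⟨
    used i * ∑⊎ (𝟙 ∘ witness? i)                 ≡⟨ cong (used i *_) (∑⊎-𝟙-unique (witness? i) a w (λ b wb → witness-unique i b a wb w)) ⟩
    used i * 1                                   ≡⟨ *-identityʳ (used i) ⟩
    used i                                       ∎
    where open ≡-Reasoning
  ... | no ∄w = trans (outflow-item i) (trans (∑⊎-zero _ (λ a → cong (_* 𝟙 (witness? i a)) unused)) (sym unused))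
    where unused : used i ≡ 0
          unused = cong bit (Halts-unwitnessed i ∄w)

  outflow-private : ∀ a i → P a ≡ just i → outflow (agent a) ≡ used i
  outflow-private a i Pa≡i = trans (outflow-agent a)
    (∑-*𝟙-unique used (privateOf? a) i Pa≡i (λ j Pa≡j → just-injective (trans (sym Pa≡j) Pa≡i)))

  Halts-heavyItem : ∀ A → Halts (heavyItem A) ≡ outcome (afterAgent (Pₕ A))
  Halts-heavyItem A = Halts-witness (heavyItem A) (inj₂ A) refl

  inflow-heavy : ∀ A → inflow (agent (inj₂ A)) ≡ used (heavyItem A)
  inflow-heavy A = trans (inflow-agent (inj₂ A))
    (∑-*𝟙-unique used (_≟ᶠ heavyItem A) (heavyItem A) refl (λ _ j≡ → j≡))

  ∑-used-lightWitness : ∀ A (s : LightSatisfied A) → proj₂ sat A ≡ s →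
                        ∑[ j < m ] (used j * 𝟙 (lightWitness? s j)) ≡ used (h A) * N A
  ∑-used-lightWitness A (inj₁ σhA≡A) sat≡ =
    trans (∑-zero _ (λ j → *-zeroʳ (used j))) (cong (_* N A) (sym unused))
    where
      unwitnessed : ¬ ∃ (Witness (h A))
      unwitnessed (a , w) with just-injective (trans (sym σhA≡A) (witness-assigned (h A) a w))
      ... | refl = subst (λ s → LightWitness s (h A)) sat≡ w
      unused : used (h A) ≡ 0
      unused = cong bit (Halts-unwitnessed (h A) unwitnessed)
  ∑-used-lightWitness A s@(inj₂ (f , f-inj , _)) sat≡ =
    trans (∑-*𝟙-constant used (lightWitness? s) (used (h A)) witness-used) (cong (used (h A) *_) (∑-𝟙-image f f-inj))
    where
      witness-used : ∀ j → LightWitness s j → used j ≡ used (h A)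
      witness-used j w = cong bit (Halts-witness j (inj₁ A) (subst (λ s → LightWitness s j) (sym sat≡) w))

  inflow-light : ∀ A → inflow (agent (inj₁ A)) ≡ used (h A) * N A
  inflow-light A = trans (inflow-agent (inj₁ A)) (∑-used-lightWitness A (proj₂ sat A) refl)

  feasible : Feasible F
  feasible = heavy-terminal , heavy-nonTerminal , item-balanced , light-balanced
    where
      heavy-terminal : ∀ A → IsTerminal A → inflow (agent (inj₂ A)) ≡ 1
      heavy-terminal A terminal =
        trans (inflow-heavy A) (cong bit (trans (Halts-heavyItem A) (cong (outcome ∘ afterAgent) terminal)))

      heavy-nonTerminal : ∀ A → ¬ IsTerminal A →
        (inflow (agent (inj₂ A)) ≡ 1 × outflow (agent (inj₂ A)) ≡ 1)
        ⊎ (inflow (agent (inj₂ A)) ≡ 0 × outflow (agent (inj₂ A)) ≡ 0)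
      heavy-nonTerminal A ¬terminal with Pₕ A in Pₕ≡
      ... | nothing = ⊥-elim (¬terminal refl)
      ... | just i  = bit-cases₁ (Halts i)
        (trans (inflow-heavy A) (cong bit (trans (Halts-heavyItem A) (cong (outcome ∘ afterAgent) Pₕ≡))))
        (outflow-private (inj₂ A) i Pₕ≡)

      item-balanced : ∀ i → (inflow (item i) ≡ 1 × outflow (item i) ≡ 1) ⊎ (inflow (item i) ≡ 0 × outflow (item i) ≡ 0)
      item-balanced i = bit-cases₁ (Halts i) (inflow-item≡used i) (outflow-item≡used i)

      light-balanced : ∀ A →
        (inflow (agent (inj₁ A)) ≡ N A × outflow (agent (inj₁ A)) ≡ 1)
        ⊎ (inflow (agent (inj₁ A)) ≡ 0 × outflow (agent (inj₁ A)) ≡ 0)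
      light-balanced A = bit-cases (Halts (h A)) (N A) (inflow-light A) (outflow-private (inj₁ A) (h A) refl)

lemma2 : (I : Instance) → (∃ λ (σ : Assignment I) → OneSatisfiesAll I σ) → (P : GoodPrivate I) → ∃ λ (F : Network.Flow I P) → Network.Feasible I P F
lemma2 I (σ , sat) P = F , feasible
  where open FeasibleFlow I σ sat P
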